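{- Let $\mathbb F_q$ be a finite field of odd characteristic and let $M=(E,r)$ be an $\mathbb F_q$-linear matroid (representable by a matrix over $\mathbb F_q$) on a finite set $E$ with rank function $r$. Then, with $q$ the number of elements of the field, $$\chi_{M^\perp}(q)=(q-1)^{|E|}\sum_{A\subseteq E}\Big(\frac{q}{1-q}\Big)^{|A|}\frac{\chi_{M|_A}(q)}{q^{r(A)}}\quad\text{and}\quad \chi_{M^\perp}(q)=q^{ -r(E)}\sum_{A\subseteq E}(-1)^{|E|-|A|}(q-1)^{|A|}\chi_{M/A}(q).$$
   Context: For a matroid $N$ on ground set $S$ with rank function $r_N$, $\chi_N(x)=\sum_{X\subseteq S}(-1)^{|X|}x^{r_N(S)-r_N(X)}$. $M^\perp$ is the dual matroid with rank function $r^\perp(A)=|A|-r(E)+r(E\setminus A)$. $M|_A$ is the restriction of $M$ to $A$, and $M/A$ the contraction of $A$ (ground set $E\setminus A$, rank $X\mapsto r(X\cup A)-r(A)$). -}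

module Defs where

open import Level using (Level; suc; _⊔_)
open import Data.Nat as ℕ using (ℕ; zero; _∸_)
open import Data.Integer as ℤ using (ℤ; +_)
open import Data.Rational.Unnormalised as ℚᵘ using (ℚᵘ; mkℚᵘ)
open import Data.Fin using (Fin)
open import Data.Fin.Subset using (Subset; _∈_; _⊆_; ∣_∣; ∁; _∪_; ⊤)
open import Data.Fin.Subset.Properties using (_⊆?_)
open import Data.List using (List; []; _∷_; map; _++_; foldr; filter)
open import Data.Vec using (Vec; []; _∷_)
open import Data.Bool using (Bool; true; false)
open import Data.Product using (Σ; _×_; ∃)
open import Function.Bundles using (_↔_)
open import Relation.Nullary using (¬_)
open import Relation.Binary.PropositionalEquality using (_≡_)
open import Algebra.Structures using (IsCommutativeRing)

record FiniteField : Set₁ where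
  field
    Carrier : Set
    _+_ _*_ : Carrier → Carrier → Carrier
    -_ : Carrier → Carrier
    0# 1# : Carrier
    isCommutativeRing : IsCommutativeRing _≡_ _+_ _*_ -_ 0# 1#
    0≢1 : ¬ (0# ≡ 1#)
    inverse : ∀ x → ¬ (x ≡ 0#) → Σ Carrier (λ y → (x * y) ≡ 1#)
    size : ℕ
    enumeration : Fin size ↔ Carrier

-- odd characteristic (characteristic of a finite field is a prime p;
-- p odd  ⇔  p ≠ 2  ⇔  1 + 1 ≠ 0)
OddCharacteristic : FiniteField → Set
OddCharacteristic F = ¬ ((1# + 1#) ≡ 0#)
  where open FiniteField F

-- Linear algebra over F: a matrix with m rows and n columns, given by
-- its columns  v i : Fin m → F  (i : Fin n).

module _ (F : FiniteField) where
  open FiniteField F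

  sumOver : ∀ {n} → Subset n → (Fin n → Carrier) → Carrier
  sumOver {zero}    []          f = 0#
  sumOver {ℕ.suc n} (true ∷ Y)  f = f Fin.zero + sumOver Y (λ i → f (Fin.suc i))
    where import Data.Fin as Fin
  sumOver {ℕ.suc n} (false ∷ Y) f = sumOver Y (λ i → f (Fin.suc i))
    where import Data.Fin as Fin

  LinIndep : ∀ {m n} → (Fin n → Fin m → Carrier) → Subset n → Set
  LinIndep {m} {n} v Y =
    (c : Fin n → Carrier) →
    (∀ (j : Fin m) → sumOver Y (λ i → c i * v i j) ≡ 0#) →
    ∀ i → i ∈ Y → c i ≡ 0#

  IsRankOf : ∀ {m n} → (Fin n → Fin m → Carrier) → Subset n → ℕ → Set
  IsRankOf v X k =
    (∃ λ Y → Y ⊆ X × LinIndep v Y × ∣ Y ∣ ≡ k) ×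
    (∀ Y → Y ⊆ X → LinIndep v Y → ∣ Y ∣ ℕ.≤ k)

  IsFLinear : ∀ {n} → (Subset n → ℕ) → Set
  IsFLinear {n} r =
    Σ ℕ λ m → Σ (Fin n → Fin m → Carrier) λ v → ∀ X → IsRankOf v X (r X)

allSubsets : ∀ n → List (Subset n)
allSubsets zero      = [] ∷ []
allSubsets (ℕ.suc n) = map (true ∷_) (allSubsets n) ++ map (false ∷_) (allSubsets n)

subsetsOf : ∀ {n} → Subset n → List (Subset n)
subsetsOf {n} S = filter (_⊆? S) (allSubsets n)

sumℤ : List ℤ → ℤ
sumℤ = foldr ℤ._+_ (+ 0)

sumℚ : List ℚᵘ → ℚᵘ
sumℚ = foldr ℚᵘ._+_ ℚᵘ.0ℚᵘ

_^ℚ_ : ℚᵘ → ℕ → ℚᵘ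
p ^ℚ zero      = ℚᵘ.1ℚᵘ
p ^ℚ ℕ.suc k   = p ℚᵘ.* (p ^ℚ k)

ι : ℤ → ℚᵘ
ι z = mkℚᵘ z 0

-- 1 / d for d ≥ 1  (mkℚᵘ a k denotes a / (k+1))
1/ℕ : ℕ → ℚᵘ
1/ℕ d = mkℚᵘ (+ 1) (d ∸ 1)

-- Characteristic polynomial of a matroid N on ground set S ⊆ Fin n with
-- rank function ρ (on subsets of S), evaluated at an integer x:
--   χ_N(x) = Σ_{X ⊆ S} (-1)^{|X|} x^{ρ(S) - ρ(X)}

χ : ∀ {n} → (S : Subset n) → (Subset n → ℕ) → ℤ → ℤ
χ S ρ x = sumℤ (map (λ X → (ℤ.- (+ 1)) ℤ.^ ∣ X ∣ ℤ.* (x ℤ.^ (ρ S ∸ ρ X))) (subsetsOf S))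

dualRank : ∀ {n} → (Subset n → ℕ) → Subset n → ℕ
dualRank r A = (∣ A ∣ ℕ.+ r (∁ A)) ∸ r ⊤

-- rank function of the contraction M / A (ground set E \ A):
--   X ↦ r(X ∪ A) - r(A)
contractRank : ∀ {n} → (Subset n → ℕ) → Subset n → Subset n → ℕ
contractRank r A X = r (X ∪ A) ∸ r A
-- (the restriction M|_A has ground set A and rank function r itself)

-- Complementing the summation variable turns χ_{M⊥}(q) into the corank sum
-- Σ_B (-1)^{|E∖B|} q^{|B|-r(B)}; both formulas are exchanges of summation over the
-- Boolean lattice that collapse to it by the binomial theorem.  Expanding
-- χ_{M|A}(q)/q^{r(A)} = Σ_{X⊆A} (-1)^{|X|} q^{-r(X)}, the identity
--   Σ_A α^{|E∖A|} β^{|A|} Σ_{X⊆A} φ(X) = Σ_X (α+β)^{|E∖X|} β^{|X|} φ(X)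
-- with α = q-1, β = -q (so α+β = -1) gives the first formula.  Expanding
-- χ_{M/A}(q) = Σ_{X⊆E∖A} (-1)^{|X|} q^{r(E)-r(X∪A)} and summing over the supersets
-- B = X ∪ A of A instead, the weight of B becomes (-1)^{|E∖B|} ((q-1)+1)^{|B|}, which
-- gives q^{r(E)} χ_{M⊥}(q).  This works in any commutative ring in which q is
-- invertible, and uses only r(X) ≤ |X|, monotonicity and subadditivity of r.

module Submission where

open import Algebra.Bundles using (CommutativeRing)
open import Data.Fin.Subset using (Subset; ∣_∣; ∁; ⊤)
open import Data.Fin.Subset.Properties using (∣∁p∣≡n∸∣p∣)
open import Data.List using (List; []; _∷_; map)
import Data.List.Properties as List
open import Data.Nat as ℕ using (ℕ; zero; suc; _∸_; _≤_; z≤n; s≤s)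
import Data.Nat.Properties as ℕₚ
open import Data.Integer as ℤ using (ℤ; +_; -[1+_])
import Data.Integer.Properties as ℤₚ
open import Data.Rational.Unnormalised as ℚ using (ℚᵘ; mkℚᵘ; _≃_; *≡*)
import Data.Rational.Unnormalised.Properties as ℚₚ
open import Data.Product using (_,_)
open import Function using (_∘_)
import Relation.Binary.PropositionalEquality as ≡
open ≡ using (_≡_)

open import Defs

module SubsetProperties where
  open import Data.Empty using (⊥-elim)
  open import Data.Fin.Subset using (inside; outside; _⊆_; _∪_; _∩_)
  open import Data.Fin.Subset.Properties using (∣p∣≤n; x∈p∩q⁻; x∈p∪q⁻; x∈∁p⇒x∉p)
  open import Data.Nat using (_+_)
  open import Data.Sum using (inj₁; inj₂)
  open import Data.Vec using ([]; _∷_)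
  open ≡ using (refl; sym; trans; cong)

  ∁-involutive : ∀ {n} (p : Subset n) → ∁ (∁ p) ≡ p
  ∁-involutive []            = refl
  ∁-involutive (inside  ∷ p) = cong (inside ∷_) (∁-involutive p)
  ∁-involutive (outside ∷ p) = cong (outside ∷_) (∁-involutive p)

  ∣∁p∣+∣p∣≡n : ∀ {n} (p : Subset n) → ∣ ∁ p ∣ + ∣ p ∣ ≡ n
  ∣∁p∣+∣p∣≡n p = trans (cong (_+ ∣ p ∣) (∣∁p∣≡n∸∣p∣ p)) (ℕₚ.m∸n+n≡m (∣p∣≤n p))

  ∣p∣≡∣p∩q∣+∣p∩∁q∣ : ∀ {n} (p q : Subset n) → ∣ p ∣ ≡ ∣ p ∩ q ∣ + ∣ p ∩ ∁ q ∣
  ∣p∣≡∣p∩q∣+∣p∩∁q∣ []            []            = refl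
  ∣p∣≡∣p∩q∣+∣p∩∁q∣ (inside  ∷ p) (inside  ∷ q) = cong suc (∣p∣≡∣p∩q∣+∣p∩∁q∣ p q)
  ∣p∣≡∣p∩q∣+∣p∩∁q∣ (inside  ∷ p) (outside ∷ q) =
    trans (cong suc (∣p∣≡∣p∩q∣+∣p∩∁q∣ p q)) (sym (ℕₚ.+-suc _ _))
  ∣p∣≡∣p∩q∣+∣p∩∁q∣ (outside ∷ p) (_       ∷ q) = ∣p∣≡∣p∩q∣+∣p∩∁q∣ p q

  p⊆q∪r⇒p∩∁q⊆r : ∀ {n} {p q r : Subset n} → p ⊆ q ∪ r → p ∩ ∁ q ⊆ r
  p⊆q∪r⇒p∩∁q⊆r {p = p} {q} {r} p⊆q∪r x∈p∩∁q with x∈p∩q⁻ p (∁ q) x∈p∩∁q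
  ... | x∈p , x∈∁q with x∈p∪q⁻ q r (p⊆q∪r x∈p)
  ...   | inj₁ x∈q = ⊥-elim (x∈∁p⇒x∉p x∈∁q x∈q)
  ...   | inj₂ x∈r = x∈r

open SubsetProperties

module RankFunctions where
  open import Data.Fin.Subset using (_⊆_; _∪_)
  open import Data.Fin.Subset.Properties using (∣⊤∣≡n; ∪-inverseˡ; q⊆p∪q)
  open import Data.Nat using (_+_)
  open ≡ using (sym; trans; cong; cong₂; subst; module ≡-Reasoning)

  -- Subadditivity is what makes the truncated subtraction in dualRank exact.
  record IsSubadditiveRank {n} (r : Subset n → ℕ) : Set where
    field
      bounded     : ∀ X → r X ≤ ∣ X ∣
      monotone    : ∀ {X Y} → X ⊆ Y → r X ≤ r Y
      subadditive : ∀ X Y → r (X ∪ Y) ≤ r X + r Y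

  [m∸o]∸[n∸o]≡m∸n : ∀ m {n o} → o ≤ n → (m ∸ o) ∸ (n ∸ o) ≡ m ∸ n
  [m∸o]∸[n∸o]≡m∸n m {n} {o} o≤n = trans (ℕₚ.∸-+-assoc m o (n ∸ o)) (cong (m ∸_) (ℕₚ.m+[n∸m]≡n o≤n))

  m+[n∸o]≡n+[m∸o] : ∀ {m n o} → o ≤ m → o ≤ n → m + (n ∸ o) ≡ n + (m ∸ o)
  m+[n∸o]≡n+[m∸o] {m} {n} {o} o≤m o≤n = begin
    m + (n ∸ o) ≡⟨ ℕₚ.+-∸-assoc m o≤n ⟨
    (m + n) ∸ o ≡⟨ cong (_∸ o) (ℕₚ.+-comm m n) ⟩
    (n + m) ∸ o ≡⟨ ℕₚ.+-∸-assoc n o≤m ⟩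
    n + (m ∸ o) ∎
    where open ≡-Reasoning

  module _ {n} {r : Subset n → ℕ} (isRank : IsSubadditiveRank r) where
    open IsSubadditiveRank isRank

    dualRank-corank : ∀ B → dualRank r ⊤ ∸ dualRank r (∁ B) ≡ ∣ B ∣ ∸ r B
    dualRank-corank B = begin
        ((∣ ⊤ {n} ∣ + r (∁ ⊤)) ∸ r ⊤) ∸ ((∣ ∁ B ∣ + r (∁ (∁ B))) ∸ r ⊤)
      ≡⟨ cong₂ (λ m X → (m ∸ r ⊤) ∸ ((∣ ∁ B ∣ + r X) ∸ r ⊤)) size-⊤ (∁-involutive B) ⟩
        ((∣ ∁ B ∣ + ∣ B ∣) ∸ r ⊤) ∸ ((∣ ∁ B ∣ + r B) ∸ r ⊤)
      ≡⟨ [m∸o]∸[n∸o]≡m∸n _ r⊤≤ ⟩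
        (∣ ∁ B ∣ + ∣ B ∣) ∸ (∣ ∁ B ∣ + r B)
      ≡⟨ ℕₚ.[m+n]∸[m+o]≡n∸o ∣ ∁ B ∣ _ _ ⟩
        ∣ B ∣ ∸ r B ∎
      where
        open ≡-Reasoning
        ∣∁⊤∣≡0 : ∣ ∁ (⊤ {n}) ∣ ≡ 0
        ∣∁⊤∣≡0 = trans (∣∁p∣≡n∸∣p∣ (⊤ {n})) (trans (cong (n ∸_) (∣⊤∣≡n n)) (ℕₚ.n∸n≡0 n))
        size-⊤ : ∣ ⊤ {n} ∣ + r (∁ ⊤) ≡ ∣ ∁ B ∣ + ∣ B ∣
        size-⊤ = trans (cong₂ _+_ (∣⊤∣≡n n) (ℕₚ.n≤0⇒n≡0 (subst (r (∁ ⊤) ≤_) ∣∁⊤∣≡0 (bounded (∁ ⊤)))))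
                       (trans (ℕₚ.+-identityʳ n) (sym (∣∁p∣+∣p∣≡n B)))
        r⊤≤ : r ⊤ ≤ ∣ ∁ B ∣ + r B
        r⊤≤ = ℕₚ.≤-trans (subst (λ X → r X ≤ r (∁ B) + r B) (∪-inverseˡ B) (subadditive (∁ B) B))
                         (ℕₚ.+-monoˡ-≤ (r B) (bounded (∁ B)))

    contractRank-corank : ∀ A X → contractRank r A (∁ A) ∸ contractRank r A X ≡ r ⊤ ∸ r (X ∪ A)
    contractRank-corank A X =
      trans (cong (λ Y → (r Y ∸ r A) ∸ (r (X ∪ A) ∸ r A)) (∪-inverseˡ A))
            ([m∸o]∸[n∸o]≡m∸n (r ⊤) (monotone (q⊆p∪q X A)))

open RankFunctions

module SubsetSums {c ℓ} (R : CommutativeRing c ℓ) where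
  open import Data.Bool using (true; false; if_then_else_)
  open import Data.Fin.Subset using (inside; outside; _⊆_; _∪_)
  open import Data.Fin.Subset.Properties using (_⊆?_; out⊆; in⊆in)
  open import Data.List using (_++_; foldr; filter)
  open import Data.Vec using ([]; _∷_)
  open import Relation.Nullary using (does)
  open import Relation.Unary using (Decidable)
  open CommutativeRing R
  open import Algebra.Properties.CommutativeSemigroup *-commutativeSemigroup using (x∙yz≈y∙xz)
  open import Algebra.Properties.Semiring.Exp semiring using (_^_)
  open import Relation.Binary.Reasoning.Setoid setoid

  ∑ : ∀ n → (Subset n → Carrier) → Carrier
  ∑ zero    f = f []
  ∑ (suc n) f = ∑ n (λ A → f (inside ∷ A)) + ∑ n (λ A → f (outside ∷ A))

  ∑⊆ : ∀ {n} → Subset n → (Subset n → Carrier) → Carrier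
  ∑⊆ []            f = f []
  ∑⊆ (inside  ∷ S) f = ∑⊆ S (λ X → f (inside ∷ X)) + ∑⊆ S (λ X → f (outside ∷ X))
  ∑⊆ (outside ∷ S) f = ∑⊆ S (λ X → f (outside ∷ X))

  ∑-cong : ∀ n {f g : Subset n → Carrier} → (∀ A → f A ≈ g A) → ∑ n f ≈ ∑ n g
  ∑-cong zero    f≈g = f≈g []
  ∑-cong (suc n) f≈g = +-cong (∑-cong n (f≈g ∘ (inside ∷_))) (∑-cong n (f≈g ∘ (outside ∷_)))

  ∑⊆-cong : ∀ {n} (S : Subset n) {f g : Subset n → Carrier} →
            (∀ X → X ⊆ S → f X ≈ g X) → ∑⊆ S f ≈ ∑⊆ S g
  ∑⊆-cong []            f≈g = f≈g [] (λ ())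
  ∑⊆-cong (inside  ∷ S) f≈g =
    +-cong (∑⊆-cong S (λ X X⊆S → f≈g (inside ∷ X) (in⊆in X⊆S)))
           (∑⊆-cong S (λ X X⊆S → f≈g (outside ∷ X) (out⊆ X⊆S)))
  ∑⊆-cong (outside ∷ S) f≈g = ∑⊆-cong S (λ X X⊆S → f≈g (outside ∷ X) (out⊆ X⊆S))

  *-distribˡ-∑ : ∀ n a (f : Subset n → Carrier) → a * ∑ n f ≈ ∑ n (λ A → a * f A)
  *-distribˡ-∑ zero    a f = refl
  *-distribˡ-∑ (suc n) a f = trans (distribˡ a _ _) (+-cong (*-distribˡ-∑ n a _) (*-distribˡ-∑ n a _))

  *-distribˡ-∑⊆ : ∀ {n} (S : Subset n) a f → a * ∑⊆ S f ≈ ∑⊆ S (λ X → a * f X)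
  *-distribˡ-∑⊆ []            a f = refl
  *-distribˡ-∑⊆ (inside  ∷ S) a f = trans (distribˡ a _ _) (+-cong (*-distribˡ-∑⊆ S a _) (*-distribˡ-∑⊆ S a _))
  *-distribˡ-∑⊆ (outside ∷ S) a f = *-distribˡ-∑⊆ S a _

  ∑-distrib-+ : ∀ n (f g : Subset n → Carrier) → ∑ n (λ A → f A + g A) ≈ ∑ n f + ∑ n g
  ∑-distrib-+ zero    f g = refl
  ∑-distrib-+ (suc n) f g = trans (+-cong (∑-distrib-+ n _ _) (∑-distrib-+ n _ _)) (+-interchange _ _ _ _)
    where open import Algebra.Properties.CommutativeSemigroup +-commutativeSemigroup
            using () renaming (interchange to +-interchange)

  ∑-zero : ∀ n → ∑ n (λ _ → 0#) ≈ 0#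
  ∑-zero zero    = refl
  ∑-zero (suc n) = trans (+-cong (∑-zero n) (∑-zero n)) (+-identityˡ 0#)

  ∑-∁ : ∀ n (f : Subset n → Carrier) → ∑ n f ≈ ∑ n (f ∘ ∁)
  ∑-∁ zero    f = refl
  ∑-∁ (suc n) f = trans (+-comm _ _) (+-cong (∑-∁ n _) (∑-∁ n _))

  ∑⊆-⊤ : ∀ n (f : Subset n → Carrier) → ∑⊆ ⊤ f ≈ ∑ n f
  ∑⊆-⊤ zero    f = refl
  ∑⊆-⊤ (suc n) f = +-cong (∑⊆-⊤ n _) (∑⊆-⊤ n _)

  ∑-indicator : ∀ {n} (S : Subset n) (f : Subset n → Carrier) →
                ∑ n (λ X → if does (X ⊆? S) then f X else 0#) ≈ ∑⊆ S f
  ∑-indicator []            f = refl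
  ∑-indicator (inside  ∷ S) f = +-cong (∑-indicator S _) (∑-indicator S _)
  ∑-indicator {suc n} (outside ∷ S) f = trans (+-cong (∑-zero n) (∑-indicator S _)) (+-identityˡ _)

  listSum : List Carrier → Carrier
  listSum = foldr _+_ 0#

  listSum-++ : ∀ xs ys → listSum (xs ++ ys) ≈ listSum xs + listSum ys
  listSum-++ []       ys = sym (+-identityˡ _)
  listSum-++ (x ∷ xs) ys = trans (+-congˡ (listSum-++ xs ys)) (sym (+-assoc x _ _))

  listSum-map-allSubsets : ∀ n (f : Subset n → Carrier) → listSum (map f (allSubsets n)) ≈ ∑ n f
  listSum-map-allSubsets zero    f = +-identityʳ _
  listSum-map-allSubsets (suc n) f = begin
    listSum (map f (map (inside ∷_) As ++ map (outside ∷_) As))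
      ≡⟨ ≡.cong listSum (List.map-++ f (map (inside ∷_) As) _) ⟩
    listSum (map f (map (inside ∷_) As) ++ map f (map (outside ∷_) As))
      ≈⟨ listSum-++ (map f (map (inside ∷_) As)) _ ⟩
    listSum (map f (map (inside ∷_) As)) + listSum (map f (map (outside ∷_) As))
      ≡⟨ ≡.cong₂ _+_ (≡.cong listSum (≡.sym (List.map-∘ As))) (≡.cong listSum (≡.sym (List.map-∘ As))) ⟩
    listSum (map (f ∘ (inside ∷_)) As) + listSum (map (f ∘ (outside ∷_)) As)
      ≈⟨ +-cong (listSum-map-allSubsets n _) (listSum-map-allSubsets n _) ⟩
    ∑ (suc n) f ∎
    where
      As = allSubsets n

  listSum-map-filter : ∀ {a p} {A : Set a} {P : A → Set p} (P? : Decidable P) (f : A → Carrier) xs →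
    listSum (map f (filter P? xs)) ≈ listSum (map (λ x → if does (P? x) then f x else 0#) xs)
  listSum-map-filter P? f []       = refl
  listSum-map-filter P? f (x ∷ xs) with does (P? x)
  ... | true  = +-congˡ (listSum-map-filter P? f xs)
  ... | false = trans (listSum-map-filter P? f xs) (sym (+-identityˡ _))

  listSum-map-subsetsOf : ∀ {n} (S : Subset n) f → listSum (map f (subsetsOf S)) ≈ ∑⊆ S f
  listSum-map-subsetsOf {n} S f = begin
    listSum (map f (subsetsOf S))  ≈⟨ listSum-map-filter (_⊆? S) f (allSubsets n) ⟩
    listSum (map _ (allSubsets n)) ≈⟨ listSum-map-allSubsets n _ ⟩
    ∑ n _                          ≈⟨ ∑-indicator S f ⟩
    ∑⊆ S f                         ∎

  weight : ∀ {n} → Carrier → Carrier → Subset n → Carrier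
  weight α β A = α ^ ∣ ∁ A ∣ * β ^ ∣ A ∣

  ∑-weight-inside : ∀ n α β (f : Subset n → Carrier) →
    ∑ n (λ A → weight α β (inside ∷ A) * f A) ≈ β * ∑ n (λ A → weight α β A * f A)
  ∑-weight-inside n α β f = trans (∑-cong n shift) (sym (*-distribˡ-∑ n β _))
    where
      shift : ∀ A → (α ^ ∣ ∁ A ∣ * (β * β ^ ∣ A ∣)) * f A ≈ β * (weight α β A * f A)
      shift A = trans (*-congʳ (x∙yz≈y∙xz _ β _)) (*-assoc β _ _)

  ∑-weight-outside : ∀ n α β (f : Subset n → Carrier) →
    ∑ n (λ A → weight α β (outside ∷ A) * f A) ≈ α * ∑ n (λ A → weight α β A * f A)
  ∑-weight-outside n α β f = trans (∑-cong n shift) (sym (*-distribˡ-∑ n α _))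
    where
      shift : ∀ A → ((α * α ^ ∣ ∁ A ∣) * β ^ ∣ A ∣) * f A ≈ α * (weight α β A * f A)
      shift A = trans (*-congʳ (*-assoc α _ _)) (*-assoc α _ _)

  ∑-binomial-subsets : ∀ n α β (φ : Subset n → Carrier) →
    ∑ n (λ A → weight α β A * ∑⊆ A φ) ≈ ∑ n (λ X → weight (α + β) β X * φ X)
  ∑-binomial-subsets zero    α β φ = refl
  ∑-binomial-subsets (suc n) α β φ = begin
      ∑ n (λ A → weight α β (inside ∷ A) * (∑⊆ A φᵢ + ∑⊆ A φₒ))
        + ∑ n (λ A → weight α β (outside ∷ A) * ∑⊆ A φₒ)
    ≈⟨ +-congʳ (trans (∑-cong n (λ A → distribˡ _ _ _)) (∑-distrib-+ n _ _)) ⟩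
      (∑ n (λ A → weight α β (inside ∷ A) * ∑⊆ A φᵢ) + ∑ n (λ A → weight α β (inside ∷ A) * ∑⊆ A φₒ))
        + ∑ n (λ A → weight α β (outside ∷ A) * ∑⊆ A φₒ)
    ≈⟨ +-cong (+-cong (∑-weight-inside n α β _) (∑-weight-inside n α β _)) (∑-weight-outside n α β _) ⟩
      (β * Lhs φᵢ + β * Lhs φₒ) + α * Lhs φₒ
    ≈⟨ +-cong (+-cong (*-congˡ (∑-binomial-subsets n α β φᵢ)) (*-congˡ (∑-binomial-subsets n α β φₒ)))
              (*-congˡ (∑-binomial-subsets n α β φₒ)) ⟩
      (β * Rhs φᵢ + β * Rhs φₒ) + α * Rhs φₒ
    ≈⟨ +-assoc _ _ _ ⟩
      β * Rhs φᵢ + (β * Rhs φₒ + α * Rhs φₒ)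
    ≈⟨ +-congˡ (trans (sym (distribʳ _ β α)) (*-congʳ (+-comm β α))) ⟩
      β * Rhs φᵢ + (α + β) * Rhs φₒ
    ≈⟨ sym (+-cong (∑-weight-inside n (α + β) β φᵢ) (∑-weight-outside n (α + β) β φₒ)) ⟩
      ∑ n (λ X → weight (α + β) β (inside ∷ X) * φᵢ X) + ∑ n (λ X → weight (α + β) β (outside ∷ X) * φₒ X)
    ∎
    where
      φᵢ φₒ : Subset n → Carrier
      φᵢ X = φ (inside ∷ X)
      φₒ X = φ (outside ∷ X)
      Lhs Rhs : (Subset n → Carrier) → Carrier
      Lhs ψ = ∑ n (λ A → weight α β A * ∑⊆ A ψ)
      Rhs ψ = ∑ n (λ X → weight (α + β) β X * ψ X)

  ∑-binomial-supersets : ∀ n α δ ε (ψ : Subset n → Carrier) →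
    ∑ n (λ A → weight α δ A * ∑⊆ (∁ A) (λ X → ε ^ ∣ X ∣ * ψ (X ∪ A)))
      ≈ ∑ n (λ B → weight α (δ + α * ε) B * ψ B)
  ∑-binomial-supersets zero    α δ ε ψ = *-congˡ (*-identityˡ _)
  ∑-binomial-supersets (suc n) α δ ε ψ = begin
      ∑ n (λ A → weight α δ (inside ∷ A) * T ψᵢ A)
        + ∑ n (λ A → weight α δ (outside ∷ A) * (∑⊆ (∁ A) (λ X → (ε * ε ^ ∣ X ∣) * ψᵢ (X ∪ A)) + T ψₒ A))
    ≈⟨ +-cong (∑-weight-inside n α δ _)
              (trans (∑-cong n (λ A → *-congˡ (+-congʳ (pull-ε A)))) (∑-weight-outside n α δ _)) ⟩
      δ * Lhs ψᵢ + α * ∑ n (λ A → weight α δ A * (ε * T ψᵢ A + T ψₒ A))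
    ≈⟨ +-congˡ (*-congˡ (trans (∑-cong n (λ A → trans (distribˡ _ _ _) (+-congʳ (x∙yz≈y∙xz _ ε _))))
                               (trans (∑-distrib-+ n _ _) (+-congʳ (sym (*-distribˡ-∑ n ε _)))))) ⟩
      δ * Lhs ψᵢ + α * (ε * Lhs ψᵢ + Lhs ψₒ)
    ≈⟨ +-congˡ (trans (distribˡ α _ _) (+-congʳ (sym (*-assoc α ε _)))) ⟩
      δ * Lhs ψᵢ + ((α * ε) * Lhs ψᵢ + α * Lhs ψₒ)
    ≈⟨ trans (sym (+-assoc _ _ _)) (+-congʳ (sym (distribʳ _ δ (α * ε)))) ⟩
      (δ + α * ε) * Lhs ψᵢ + α * Lhs ψₒ
    ≈⟨ +-cong (*-congˡ (∑-binomial-supersets n α δ ε ψᵢ)) (*-congˡ (∑-binomial-supersets n α δ ε ψₒ)) ⟩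
      (δ + α * ε) * Rhs ψᵢ + α * Rhs ψₒ
    ≈⟨ sym (+-cong (∑-weight-inside n α (δ + α * ε) ψᵢ) (∑-weight-outside n α (δ + α * ε) ψₒ)) ⟩
      ∑ n (λ B → weight α (δ + α * ε) (inside ∷ B) * ψᵢ B) + ∑ n (λ B → weight α (δ + α * ε) (outside ∷ B) * ψₒ B)
    ∎
    where
      ψᵢ ψₒ : Subset n → Carrier
      ψᵢ X = ψ (inside ∷ X)
      ψₒ X = ψ (outside ∷ X)
      T : (Subset n → Carrier) → Subset n → Carrier
      T h A = ∑⊆ (∁ A) (λ X → ε ^ ∣ X ∣ * h (X ∪ A))
      Lhs Rhs : (Subset n → Carrier) → Carrier
      Lhs h = ∑ n (λ A → weight α δ A * T h A)
      Rhs h = ∑ n (λ B → weight α (δ + α * ε) B * h B)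
      pull-ε : ∀ A → ∑⊆ (∁ A) (λ X → (ε * ε ^ ∣ X ∣) * ψᵢ (X ∪ A)) ≈ ε * T ψᵢ A
      pull-ε A = trans (∑⊆-cong (∁ A) (λ X _ → *-assoc ε _ _)) (sym (*-distribˡ-∑⊆ (∁ A) ε _))

module CharacteristicPolynomial {c ℓ} (R : CommutativeRing c ℓ) where
  open import Data.Fin.Subset using (_⊆_; _∪_)
  open import Data.Fin.Subset.Properties using (⊆⊤)
  open CommutativeRing R
  open SubsetSums R
  open import Algebra.Properties.Ring ring using (-1*x≈-x; -‿involutive)
  open import Algebra.Properties.Semiring.Exp semiring using (_^_; ^-congˡ; ^-congʳ; ^-homo-*)
  open import Algebra.Properties.CommutativeSemiring.Exp commutativeSemiring using (^-distrib-*)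
  open import Algebra.Properties.CommutativeSemigroup *-commutativeSemigroup using (interchange; x∙yz≈y∙xz)
  open import Relation.Binary.Reasoning.Setoid setoid

  -1*-1≈1 : - 1# * - 1# ≈ 1#
  -1*-1≈1 = trans (-1*x≈-x (- 1#)) (-‿involutive 1#)

  -x*-1≈x : ∀ x → - x * - 1# ≈ x
  -x*-1≈x x = trans (*-comm (- x) (- 1#)) (trans (-1*x≈-x (- x)) (-‿involutive x))

  [x-1]+1≈x : ∀ x → (x - 1#) + 1# ≈ x
  [x-1]+1≈x x = trans (+-assoc x (- 1#) 1#) (trans (+-congˡ (-‿inverseˡ 1#)) (+-identityʳ x))

  [x-1]-x≈-1 : ∀ x → (x - 1#) - x ≈ - 1#
  [x-1]-x≈-1 x = begin
    (x - 1#) - x    ≈⟨ +-congʳ (+-comm x (- 1#)) ⟩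
    (- 1# + x) - x  ≈⟨ +-assoc (- 1#) x (- x) ⟩
    - 1# + (x - x)  ≈⟨ +-congˡ (-‿inverseʳ x) ⟩
    - 1# + 0#       ≈⟨ +-identityʳ (- 1#) ⟩
    - 1#            ∎

  x^k*u^k≈1 : ∀ {x u} → x * u ≈ 1# → ∀ k → x ^ k * u ^ k ≈ 1#
  x^k*u^k≈1 xu≈1 zero    = *-identityˡ 1#
  x^k*u^k≈1 {x} {u} xu≈1 (suc k) = begin
    (x * x ^ k) * (u * u ^ k) ≈⟨ interchange x (x ^ k) u (u ^ k) ⟩
    (x * u) * (x ^ k * u ^ k) ≈⟨ *-cong xu≈1 (x^k*u^k≈1 xu≈1 k) ⟩
    1# * 1#                   ≈⟨ *-identityˡ 1# ⟩
    1#                        ∎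

  x^m≈x^[m∸k]*x^k : ∀ x {k m} → k ≤ m → x ^ m ≈ x ^ (m ∸ k) * x ^ k
  x^m≈x^[m∸k]*x^k x {k} {m} k≤m = trans (^-congʳ x (≡.sym (ℕₚ.m∸n+n≡m k≤m))) (^-homo-* x (m ∸ k) k)

  x^[m∸k]*u^m≈u^k : ∀ {x u} → x * u ≈ 1# → ∀ {k m} → k ≤ m → x ^ (m ∸ k) * u ^ m ≈ u ^ k
  x^[m∸k]*u^m≈u^k {x} {u} xu≈1 {k} {m} k≤m = begin
    x ^ (m ∸ k) * u ^ m                   ≈⟨ *-congˡ (x^m≈x^[m∸k]*x^k u k≤m) ⟩
    x ^ (m ∸ k) * (u ^ (m ∸ k) * u ^ k)   ≈⟨ *-assoc _ _ _ ⟨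
    (x ^ (m ∸ k) * u ^ (m ∸ k)) * u ^ k   ≈⟨ *-congʳ (x^k*u^k≈1 xu≈1 (m ∸ k)) ⟩
    1# * u ^ k                            ≈⟨ *-identityˡ _ ⟩
    u ^ k                                 ∎

  x^m*u^k≈x^[m∸k] : ∀ {x u} → x * u ≈ 1# → ∀ {k m} → k ≤ m → x ^ m * u ^ k ≈ x ^ (m ∸ k)
  x^m*u^k≈x^[m∸k] {x} {u} xu≈1 {k} {m} k≤m = begin
    x ^ m * u ^ k                       ≈⟨ *-congʳ (x^m≈x^[m∸k]*x^k x k≤m) ⟩
    (x ^ (m ∸ k) * x ^ k) * u ^ k       ≈⟨ *-assoc _ _ _ ⟩
    x ^ (m ∸ k) * (x ^ k * u ^ k)       ≈⟨ *-congˡ (x^k*u^k≈1 xu≈1 k) ⟩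
    x ^ (m ∸ k) * 1#                    ≈⟨ *-identityʳ _ ⟩
    x ^ (m ∸ k)                         ∎

  charPoly : ∀ {n} → Subset n → (Subset n → ℕ) → Carrier → Carrier
  charPoly S ρ x = ∑⊆ S (λ X → (- 1#) ^ ∣ X ∣ * x ^ (ρ S ∸ ρ X))

  module _ {n} {r : Subset n → ℕ} (isRank : IsSubadditiveRank r) where
    open IsSubadditiveRank isRank

    charPoly-dual : ∀ x → charPoly ⊤ (dualRank r) x ≈ ∑ n (λ B → (- 1#) ^ ∣ ∁ B ∣ * x ^ (∣ B ∣ ∸ r B))
    charPoly-dual x = begin
      charPoly ⊤ (dualRank r) x
        ≈⟨ ∑⊆-⊤ n _ ⟩
      ∑ n (λ X → (- 1#) ^ ∣ X ∣ * x ^ (dualRank r ⊤ ∸ dualRank r X))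
        ≈⟨ ∑-∁ n _ ⟩
      ∑ n (λ B → (- 1#) ^ ∣ ∁ B ∣ * x ^ (dualRank r ⊤ ∸ dualRank r (∁ B)))
        ≈⟨ ∑-cong n (λ B → *-congˡ (^-congʳ x (dualRank-corank isRank B))) ⟩
      ∑ n (λ B → (- 1#) ^ ∣ ∁ B ∣ * x ^ (∣ B ∣ ∸ r B)) ∎

    charPoly-dual-by-contractions : ∀ x →
      x ^ r ⊤ * charPoly ⊤ (dualRank r) x
        ≈ ∑ n (λ A → weight (- 1#) (x - 1#) A * charPoly (∁ A) (contractRank r A) x)
    charPoly-dual-by-contractions x = sym (begin
        ∑ n (λ A → weight (- 1#) (x - 1#) A * charPoly (∁ A) (contractRank r A) x)
      ≈⟨ ∑-cong n (λ A → *-congˡ (∑⊆-cong (∁ A) (λ X _ → *-congˡ (^-congʳ x (contractRank-corank isRank A X))))) ⟩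
        ∑ n (λ A → weight (- 1#) (x - 1#) A * ∑⊆ (∁ A) (λ X → (- 1#) ^ ∣ X ∣ * x ^ (r ⊤ ∸ r (X ∪ A))))
      ≈⟨ ∑-binomial-supersets n (- 1#) (x - 1#) (- 1#) (λ B → x ^ (r ⊤ ∸ r B)) ⟩
        ∑ n (λ B → weight (- 1#) ((x - 1#) + - 1# * - 1#) B * x ^ (r ⊤ ∸ r B))
      ≈⟨ ∑-cong n factor-x^r⊤ ⟩
        ∑ n (λ B → x ^ r ⊤ * ((- 1#) ^ ∣ ∁ B ∣ * x ^ (∣ B ∣ ∸ r B)))
      ≈⟨ *-distribˡ-∑ n _ _ ⟨
        x ^ r ⊤ * ∑ n (λ B → (- 1#) ^ ∣ ∁ B ∣ * x ^ (∣ B ∣ ∸ r B))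
      ≈⟨ *-congˡ (charPoly-dual x) ⟨
        x ^ r ⊤ * charPoly ⊤ (dualRank r) x ∎)
      where
        factor-x^r⊤ : ∀ B → weight (- 1#) ((x - 1#) + - 1# * - 1#) B * x ^ (r ⊤ ∸ r B)
                              ≈ x ^ r ⊤ * ((- 1#) ^ ∣ ∁ B ∣ * x ^ (∣ B ∣ ∸ r B))
        factor-x^r⊤ B = begin
          ((- 1#) ^ ∣ ∁ B ∣ * ((x - 1#) + - 1# * - 1#) ^ ∣ B ∣) * x ^ (r ⊤ ∸ r B)
            ≈⟨ *-congʳ (*-congˡ (^-congˡ ∣ B ∣ (trans (+-congˡ -1*-1≈1) ([x-1]+1≈x x)))) ⟩
          ((- 1#) ^ ∣ ∁ B ∣ * x ^ ∣ B ∣) * x ^ (r ⊤ ∸ r B)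
            ≈⟨ *-assoc _ _ _ ⟩
          (- 1#) ^ ∣ ∁ B ∣ * (x ^ ∣ B ∣ * x ^ (r ⊤ ∸ r B))
            ≈⟨ *-congˡ (^-homo-* x ∣ B ∣ (r ⊤ ∸ r B)) ⟨
          (- 1#) ^ ∣ ∁ B ∣ * x ^ (∣ B ∣ ℕ.+ (r ⊤ ∸ r B))
            ≈⟨ *-congˡ (^-congʳ x (m+[n∸o]≡n+[m∸o] (bounded B) (monotone ⊆⊤))) ⟩
          (- 1#) ^ ∣ ∁ B ∣ * x ^ (r ⊤ ℕ.+ (∣ B ∣ ∸ r B))
            ≈⟨ *-congˡ (^-homo-* x (r ⊤) (∣ B ∣ ∸ r B)) ⟩
          (- 1#) ^ ∣ ∁ B ∣ * (x ^ r ⊤ * x ^ (∣ B ∣ ∸ r B))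
            ≈⟨ x∙yz≈y∙xz _ _ _ ⟩
          x ^ r ⊤ * ((- 1#) ^ ∣ ∁ B ∣ * x ^ (∣ B ∣ ∸ r B)) ∎

    charPoly-dual-by-restrictions : ∀ {x u t} → x * u ≈ 1# → (x - 1#) * t ≈ - x →
      charPoly ⊤ (dualRank r) x ≈ (x - 1#) ^ n * ∑ n (λ A → (t ^ ∣ A ∣ * charPoly A r x) * u ^ r A)
    charPoly-dual-by-restrictions {x} {u} {t} xu≈1 [x-1]t≈-x = sym (begin
        (x - 1#) ^ n * ∑ n (λ A → (t ^ ∣ A ∣ * charPoly A r x) * u ^ r A)
      ≈⟨ *-distribˡ-∑ n _ _ ⟩
        ∑ n (λ A → (x - 1#) ^ n * ((t ^ ∣ A ∣ * charPoly A r x) * u ^ r A))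
      ≈⟨ ∑-cong n split-weight ⟩
        ∑ n (λ A → weight (x - 1#) (- x) A * ∑⊆ A (λ X → (- 1#) ^ ∣ X ∣ * u ^ r X))
      ≈⟨ ∑-binomial-subsets n (x - 1#) (- x) _ ⟩
        ∑ n (λ X → weight ((x - 1#) - x) (- x) X * ((- 1#) ^ ∣ X ∣ * u ^ r X))
      ≈⟨ ∑-cong n collapse ⟩
        ∑ n (λ B → (- 1#) ^ ∣ ∁ B ∣ * x ^ (∣ B ∣ ∸ r B))
      ≈⟨ charPoly-dual x ⟨
        charPoly ⊤ (dualRank r) x ∎)
      where
        charPoly*u^r : ∀ A → charPoly A r x * u ^ r A ≈ ∑⊆ A (λ X → (- 1#) ^ ∣ X ∣ * u ^ r X)
        charPoly*u^r A = trans (*-comm _ _) (trans (*-distribˡ-∑⊆ A _ _) (∑⊆-cong A cancel))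
          where
            cancel : ∀ X → X ⊆ A → u ^ r A * ((- 1#) ^ ∣ X ∣ * x ^ (r A ∸ r X)) ≈ (- 1#) ^ ∣ X ∣ * u ^ r X
            cancel X X⊆A = trans (x∙yz≈y∙xz _ _ _)
                                 (*-congˡ (trans (*-comm _ _) (x^[m∸k]*u^m≈u^k xu≈1 (monotone X⊆A))))

        split-weight : ∀ A → (x - 1#) ^ n * ((t ^ ∣ A ∣ * charPoly A r x) * u ^ r A)
                             ≈ weight (x - 1#) (- x) A * ∑⊆ A (λ X → (- 1#) ^ ∣ X ∣ * u ^ r X)
        split-weight A = begin
          (x - 1#) ^ n * ((t ^ ∣ A ∣ * charPoly A r x) * u ^ r A)
            ≈⟨ *-cong (trans (^-congʳ (x - 1#) (≡.sym (∣∁p∣+∣p∣≡n A))) (^-homo-* (x - 1#) ∣ ∁ A ∣ ∣ A ∣))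
                      (*-assoc _ _ _) ⟩
          ((x - 1#) ^ ∣ ∁ A ∣ * (x - 1#) ^ ∣ A ∣) * (t ^ ∣ A ∣ * (charPoly A r x * u ^ r A))
            ≈⟨ *-assoc _ _ _ ⟩
          (x - 1#) ^ ∣ ∁ A ∣ * ((x - 1#) ^ ∣ A ∣ * (t ^ ∣ A ∣ * (charPoly A r x * u ^ r A)))
            ≈⟨ *-congˡ (trans (sym (*-assoc _ _ _))
                              (*-congʳ (trans (sym (^-distrib-* (x - 1#) t ∣ A ∣)) (^-congˡ ∣ A ∣ [x-1]t≈-x)))) ⟩
          (x - 1#) ^ ∣ ∁ A ∣ * ((- x) ^ ∣ A ∣ * (charPoly A r x * u ^ r A))
            ≈⟨ trans (sym (*-assoc _ _ _)) (*-congˡ (charPoly*u^r A)) ⟩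
          weight (x - 1#) (- x) A * ∑⊆ A (λ X → (- 1#) ^ ∣ X ∣ * u ^ r X) ∎

        collapse : ∀ X → weight ((x - 1#) - x) (- x) X * ((- 1#) ^ ∣ X ∣ * u ^ r X)
                         ≈ (- 1#) ^ ∣ ∁ X ∣ * x ^ (∣ X ∣ ∸ r X)
        collapse X = begin
          (((x - 1#) - x) ^ ∣ ∁ X ∣ * (- x) ^ ∣ X ∣) * ((- 1#) ^ ∣ X ∣ * u ^ r X)
            ≈⟨ *-assoc _ _ _ ⟩
          ((x - 1#) - x) ^ ∣ ∁ X ∣ * ((- x) ^ ∣ X ∣ * ((- 1#) ^ ∣ X ∣ * u ^ r X))
            ≈⟨ *-cong (^-congˡ ∣ ∁ X ∣ ([x-1]-x≈-1 x)) (sym (*-assoc _ _ _)) ⟩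
          (- 1#) ^ ∣ ∁ X ∣ * (((- x) ^ ∣ X ∣ * (- 1#) ^ ∣ X ∣) * u ^ r X)
            ≈⟨ *-congˡ (*-congʳ (trans (sym (^-distrib-* (- x) (- 1#) ∣ X ∣)) (^-congˡ ∣ X ∣ (-x*-1≈x x)))) ⟩
          (- 1#) ^ ∣ ∁ X ∣ * (x ^ ∣ X ∣ * u ^ r X)
            ≈⟨ *-congˡ (x^m*u^k≈x^[m∸k] xu≈1 (bounded X)) ⟩
          (- 1#) ^ ∣ ∁ X ∣ * x ^ (∣ X ∣ ∸ r X) ∎

module LinearMatroids (F : FiniteField) where
  open import Algebra.Structures using (IsCommutativeRing)
  open import Data.Bool using (if_then_else_)
  open import Data.Empty using (⊥-elim)
  open import Data.Fin as Fin using (Fin)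
  open import Data.Fin.Subset using (inside; outside; _⊆_; _∪_; _∩_)
  open import Data.Fin.Subset.Properties using (p⊆q⇒∣p∣≤∣q∣; drop-∷-⊆; p∩q⊆p; p∩q⊆q)
  open import Data.Nat using (_+_)
  open import Data.Product using (proj₂)
  open import Data.Vec using ([]; _∷_; here; lookup)
  open import Data.Vec.Properties using ([]=⇒lookup)
  open import Function using (_↔_; Inverse)
  open ≡ using (refl; sym; trans; cong; cong₂; subst; module ≡-Reasoning)

  open FiniteField F using (Carrier; 0#; 1#; 0≢1; size; enumeration)
    renaming (_+_ to _+F_; _*_ to _*F_; isCommutativeRing to isCR)
  open IsCommutativeRing isCR using (zeroˡ; +-identityˡ)

  zeroOutside : ∀ {n} → Subset n → (Fin n → Carrier) → Fin n → Carrier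
  zeroOutside Z c i = if lookup Z i then c i else 0#

  sumOver-zeroOutside : ∀ {n} {Y Z : Subset n} (c w : Fin n → Carrier) → Z ⊆ Y →
    sumOver F Y (λ i → zeroOutside Z c i *F w i) ≡ sumOver F Z (λ i → c i *F w i)
  sumOver-zeroOutside {Y = []}          {[]}          c w _ = refl
  sumOver-zeroOutside {Y = inside  ∷ Y} {inside  ∷ Z} c w Z⊆Y =
    cong ((c Fin.zero *F w Fin.zero) +F_) (sumOver-zeroOutside (c ∘ Fin.suc) (w ∘ Fin.suc) (drop-∷-⊆ Z⊆Y))
  sumOver-zeroOutside {Y = inside  ∷ Y} {outside ∷ Z} c w Z⊆Y =
    trans (cong₂ _+F_ (zeroˡ (w Fin.zero)) (sumOver-zeroOutside (c ∘ Fin.suc) (w ∘ Fin.suc) (drop-∷-⊆ Z⊆Y)))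
          (+-identityˡ _)
  sumOver-zeroOutside {Y = outside ∷ Y} {outside ∷ Z} c w Z⊆Y =
    sumOver-zeroOutside (c ∘ Fin.suc) (w ∘ Fin.suc) (drop-∷-⊆ Z⊆Y)
  sumOver-zeroOutside {Y = outside ∷ Y} {inside  ∷ Z} c w Z⊆Y with () ← Z⊆Y here

  LinIndep-⊆ : ∀ {m n} {v : Fin n → Fin m → Carrier} {Y Z : Subset n} →
               Z ⊆ Y → LinIndep F v Y → LinIndep F v Z
  LinIndep-⊆ {v = v} {Z = Z} Z⊆Y indep c c·v≡0 i i∈Z =
    subst (λ b → (if b then c i else 0#) ≡ 0#) ([]=⇒lookup i∈Z)
      (indep (zeroOutside Z c) (λ j → trans (sumOver-zeroOutside c (λ i → v i j) Z⊆Y) (c·v≡0 j)) i (Z⊆Y i∈Z))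

  isFLinear⇒isSubadditiveRank : ∀ {n} {r : Subset n → ℕ} → IsFLinear F r → IsSubadditiveRank r
  isFLinear⇒isSubadditiveRank {r = r} (_ , v , isRank) = record
    { bounded     = bounded
    ; monotone    = monotone
    ; subadditive = subadditive
    }
    where
      bounded : ∀ X → r X ≤ ∣ X ∣
      bounded X with isRank X
      ... | (Y , Y⊆X , _ , ∣Y∣≡rX) , _ = subst (_≤ ∣ X ∣) ∣Y∣≡rX (p⊆q⇒∣p∣≤∣q∣ Y⊆X)

      monotone : ∀ {X Z} → X ⊆ Z → r X ≤ r Z
      monotone {X} {Z} X⊆Z with isRank X
      ... | (Y , Y⊆X , indep , ∣Y∣≡rX) , _ = subst (_≤ r Z) ∣Y∣≡rX (proj₂ (isRank Z) Y (X⊆Z ∘ Y⊆X) indep)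

      subadditive : ∀ X Z → r (X ∪ Z) ≤ r X + r Z
      subadditive X Z with isRank (X ∪ Z)
      ... | (Y , Y⊆X∪Z , indep , ∣Y∣≡r) , _ =
        subst (_≤ r X + r Z) (trans (sym (∣p∣≡∣p∩q∣+∣p∩∁q∣ Y X)) ∣Y∣≡r)
          (ℕₚ.+-mono-≤ (proj₂ (isRank X) (Y ∩ X) (p∩q⊆q Y X) (LinIndep-⊆ (p∩q⊆p Y X) indep))
                       (proj₂ (isRank Z) (Y ∩ ∁ X) (p⊆q∪r⇒p∩∁q⊆r Y⊆X∪Z) (LinIndep-⊆ (p∩q⊆p Y (∁ X)) indep)))

  size≥2 : 2 ≤ size
  size≥2 = atLeastTwo size enumeration
    where
      atLeastTwo : ∀ s → Fin s ↔ Carrier → 2 ≤ s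
      atLeastTwo zero          e with () ← Inverse.from e 0#
      atLeastTwo (suc zero)    e = ⊥-elim (0≢1 (begin
        0#                        ≡⟨ Inverse.strictlyInverseˡ e 0# ⟨
        Inverse.to e (Inverse.from e 0#) ≡⟨ cong (Inverse.to e) (Fin-1-unique _ _) ⟩
        Inverse.to e (Inverse.from e 1#) ≡⟨ Inverse.strictlyInverseˡ e 1# ⟩
        1#                        ∎))
        where
          open ≡-Reasoning
          Fin-1-unique : (a b : Fin 1) → a ≡ b
          Fin-1-unique Fin.zero Fin.zero = refl
      atLeastTwo (suc (suc s)) e = s≤s (s≤s z≤n)

open LinearMatroids

open import Relation.Binary.Reasoning.Setoid ℚₚ.≃-setoid

module Q where
  open CommutativeRing ℚₚ.+-*-commutativeRing public
  open SubsetSums ℚₚ.+-*-commutativeRing public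
  open CharacteristicPolynomial ℚₚ.+-*-commutativeRing public
  open import Algebra.Properties.Semiring.Exp semiring public using (_^_; ^-congˡ)

ι-+ : ∀ a b → ι (a ℤ.+ b) ≃ ι a ℚ.+ ι b
ι-+ a b = *≡* (≡.cong (ℤ._* + 1) (≡.sym (≡.cong₂ ℤ._+_ (ℤₚ.*-identityʳ a) (ℤₚ.*-identityʳ b))))

ι-^ : ∀ a k → ι (a ℤ.^ k) ≃ ι a Q.^ k
ι-^ a zero    = Q.refl
ι-^ a (suc k) = Q.*-congˡ (ι-^ a k)

ι-sumℤ : ∀ xs → ι (sumℤ xs) ≃ sumℚ (map ι xs)
ι-sumℤ []       = Q.refl
ι-sumℤ (x ∷ xs) = Q.trans (ι-+ x (sumℤ xs)) (Q.+-congˡ (ι-sumℤ xs))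

ι-χ : ∀ {n} (S : Subset n) ρ z → ι (χ S ρ z) ≃ Q.charPoly S ρ (ι z)
ι-χ S ρ z = begin
  ι (sumℤ (map f (subsetsOf S)))        ≈⟨ ι-sumℤ (map f (subsetsOf S)) ⟩
  sumℚ (map ι (map f (subsetsOf S)))    ≡⟨ ≡.cong sumℚ (≡.sym (List.map-∘ (subsetsOf S))) ⟩
  sumℚ (map (ι ∘ f) (subsetsOf S))      ≈⟨ Q.listSum-map-subsetsOf S (ι ∘ f) ⟩
  Q.∑⊆ S (ι ∘ f)                        ≈⟨ Q.∑⊆-cong S (λ X _ → Q.*-cong (ι-^ _ ∣ X ∣) (ι-^ z (ρ S ∸ ρ X))) ⟩
  Q.charPoly S ρ (ι z)                  ∎
  where
    f : Subset _ → ℤ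
    f X = (ℤ.- (+ 1)) ℤ.^ ∣ X ∣ ℤ.* (z ℤ.^ (ρ S ∸ ρ X))

^ℚ≡^ : ∀ p k → p ^ℚ k ≡ p Q.^ k
^ℚ≡^ p zero    = ≡.refl
^ℚ≡^ p (suc k) = ≡.cong (p ℚ.*_) (^ℚ≡^ p k)

1/ℕ-* : ∀ {a b} → 1 ≤ a → 1 ≤ b → 1/ℕ (a ℕ.* b) ≃ 1/ℕ a ℚ.* 1/ℕ b
1/ℕ-* {suc a} {suc b} _ _ =
  *≡* (≡.trans (ℤₚ.*-identityˡ _) (≡.sym (ℤₚ.*-identityˡ (ℚ.↧ (1/ℕ (suc a ℕ.* suc b))))))

1/ℕ-^ : ∀ d k → 1/ℕ (suc d ℕ.^ k) ≃ 1/ℕ (suc d) Q.^ k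
1/ℕ-^ d zero    = Q.refl
1/ℕ-^ d (suc k) = Q.trans (1/ℕ-* {suc d} {suc d ℕ.^ k} (s≤s z≤n) (ℕₚ.m^n>0 (suc d) k)) (Q.*-congˡ (1/ℕ-^ d k))

ι*1/ℕ≃1 : ∀ d → ι (+ suc d) ℚ.* 1/ℕ (suc d) ≃ Q.1#
ι*1/ℕ≃1 d = *≡* (≡.trans (ℤₚ.*-identityʳ _) (≡.trans (ℤₚ.*-identityʳ _)
  (≡.sym (≡.trans (ℤₚ.*-identityˡ _) (≡.cong (λ m → + suc m) (ℕₚ.+-identityʳ d))))))

[q-1]*q/[1-q]≃-q : ∀ k → (ι (+ suc (suc k)) Q.- Q.1#) ℚ.* mkℚᵘ (ℤ.- + suc (suc k)) k ≃ Q.- ι (+ suc (suc k))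
[q-1]*q/[1-q]≃-q k = Q.trans (Q.*-congʳ (Q.sym (ι-+ (+ suc (suc k)) (ℤ.- + 1))))
  (*≡* (≡.trans (ℤₚ.*-identityʳ (+ suc k ℤ.* ℤ.- (+ suc (suc k)))) (≡.trans (ℤₚ.*-comm (+ suc k) (ℤ.- (+ suc (suc k))))
    (≡.cong (λ m → ℤ.- (+ suc (suc k)) ℤ.* + suc m) (≡.sym (ℕₚ.+-identityʳ k))))))

module _ {n} {r : Subset n → ℕ} (isRank : IsSubadditiveRank r) where

  dual-χ-by-restrictions : ∀ q → 2 ≤ q →
    ι (χ ⊤ (dualRank r) (+ q))
      ≃ ι ((+ q ℤ.- + 1) ℤ.^ n) ℚ.* sumℚ (map (λ A → ((mkℚᵘ (ℤ.- + q) (q ∸ 2) ^ℚ ∣ A ∣) ℚ.* ι (χ A r (+ q)))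
                                                      ℚ.* 1/ℕ (q ℕ.^ r A))
                                                 (allSubsets n))
  dual-χ-by-restrictions _ (s≤s (s≤s {n = k} z≤n)) = begin
      ι (χ ⊤ (dualRank r) (+ q))
    ≈⟨ ι-χ ⊤ (dualRank r) (+ q) ⟩
      Q.charPoly ⊤ (dualRank r) x
    ≈⟨ Q.charPoly-dual-by-restrictions isRank (ι*1/ℕ≃1 (suc k)) ([q-1]*q/[1-q]≃-q k) ⟩
      (x Q.- Q.1#) Q.^ n ℚ.* Q.∑ n (λ A → (t Q.^ ∣ A ∣ ℚ.* Q.charPoly A r x) ℚ.* 1/ℕ q Q.^ r A)
    ≈⟨ Q.*-cong (Q.sym (Q.trans (ι-^ _ n) (Q.^-congˡ n (ι-+ (+ q) (ℤ.- + 1)))))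
                (Q.sym (Q.trans (Q.listSum-map-allSubsets n _) (Q.∑-cong n term))) ⟩
      ι ((+ q ℤ.- + 1) ℤ.^ n) ℚ.* sumℚ (map (λ A → ((t ^ℚ ∣ A ∣) ℚ.* ι (χ A r (+ q))) ℚ.* 1/ℕ (q ℕ.^ r A))
                                            (allSubsets n)) ∎
    where
      q : ℕ
      q = suc (suc k)
      x t : ℚᵘ
      x = ι (+ q)
      t = mkℚᵘ (ℤ.- + q) k
      term : ∀ A → ((t ^ℚ ∣ A ∣) ℚ.* ι (χ A r (+ q))) ℚ.* 1/ℕ (q ℕ.^ r A)
                   ≃ (t Q.^ ∣ A ∣ ℚ.* Q.charPoly A r x) ℚ.* 1/ℕ q Q.^ r A
      term A = Q.*-cong (Q.*-cong (Q.reflexive (^ℚ≡^ t ∣ A ∣)) (ι-χ A r (+ q))) (1/ℕ-^ (suc k) (r A))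

  dual-χ-by-contractions : ∀ q → 1 ≤ q →
    ι (χ ⊤ (dualRank r) (+ q))
      ≃ 1/ℕ (q ℕ.^ r ⊤) ℚ.* sumℚ (map (λ A → ι (((-[1+ 0 ] ℤ.^ (n ∸ ∣ A ∣)) ℤ.* ((+ q ℤ.- + 1) ℤ.^ ∣ A ∣))
                                                  ℤ.* χ (∁ A) (contractRank r A) (+ q)))
                                        (allSubsets n))
  dual-χ-by-contractions _ (s≤s {n = d} z≤n) = begin
      ι (χ ⊤ (dualRank r) (+ q))
    ≈⟨ ι-χ ⊤ (dualRank r) (+ q) ⟩
      Q.charPoly ⊤ (dualRank r) x
    ≈⟨ Q.sym (Q.trans (Q.sym (Q.*-assoc (u Q.^ r ⊤) (x Q.^ r ⊤) _))
                      (Q.trans (Q.*-congʳ (Q.x^k*u^k≈1 u*x≃1 (r ⊤))) (Q.*-identityˡ _))) ⟩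
      u Q.^ r ⊤ ℚ.* (x Q.^ r ⊤ ℚ.* Q.charPoly ⊤ (dualRank r) x)
    ≈⟨ Q.*-congˡ {u Q.^ r ⊤} (Q.charPoly-dual-by-contractions isRank x) ⟩
      u Q.^ r ⊤ ℚ.* Q.∑ n (λ A → Q.weight (Q.- Q.1#) (x Q.- Q.1#) A ℚ.* Q.charPoly (∁ A) (contractRank r A) x)
    ≈⟨ Q.*-cong (Q.sym (1/ℕ-^ d (r ⊤))) (Q.sym (Q.trans (Q.listSum-map-allSubsets n _) (Q.∑-cong n term))) ⟩
      1/ℕ (q ℕ.^ r ⊤) ℚ.* sumℚ (map (λ A → ι (((-[1+ 0 ] ℤ.^ (n ∸ ∣ A ∣)) ℤ.* ((+ q ℤ.- + 1) ℤ.^ ∣ A ∣))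
                                                ℤ.* χ (∁ A) (contractRank r A) (+ q)))
                                      (allSubsets n)) ∎
    where
      q : ℕ
      q = suc d
      x u : ℚᵘ
      x = ι (+ q)
      u = 1/ℕ q
      u*x≃1 : u ℚ.* x ≃ Q.1#
      u*x≃1 = Q.trans (Q.*-comm u x) (ι*1/ℕ≃1 d)
      term : ∀ A → ι (((-[1+ 0 ] ℤ.^ (n ∸ ∣ A ∣)) ℤ.* ((+ q ℤ.- + 1) ℤ.^ ∣ A ∣)) ℤ.* χ (∁ A) (contractRank r A) (+ q))
                   ≃ Q.weight (Q.- Q.1#) (x Q.- Q.1#) A ℚ.* Q.charPoly (∁ A) (contractRank r A) x
      term A = Q.*-cong (Q.*-cong (Q.trans (ι-^ -[1+ 0 ] (n ∸ ∣ A ∣))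
                                           (Q.reflexive (≡.cong (ι -[1+ 0 ] Q.^_) (≡.sym (∣∁p∣≡n∸∣p∣ A)))))
                                  (Q.trans (ι-^ _ ∣ A ∣) (Q.^-congˡ ∣ A ∣ (ι-+ (+ q) (ℤ.- + 1)))))
                        (ι-χ (∁ A) (contractRank r A) (+ q))

open import Data.Nat using (ℕ; _∸_)
open import Data.Integer using (ℤ; +_; -[1+_]; _-_; _*_; _^_)
open import Data.Rational.Unnormalised using (ℚᵘ; mkℚᵘ; _≃_) renaming (_*_ to _*ℚ_)
open import Data.Fin.Subset using (Subset; ∣_∣; ∁; ⊤)
open import Data.List using (map)
open import Data.Product using (_×_)

corollary2 : (F : FiniteField) → OddCharacteristic F →
    (n : ℕ) (r : Subset n → ℕ) → IsFLinear F r →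
    let q = FiniteField.size F
        qℤ = + q
        -- q / (1 - q) = - q / (q - 1)   (mkℚᵘ a k denotes a / (k+1))
        q/[1-q] = mkℚᵘ (Data.Integer.- qℤ) (q ∸ 2)
        χ⊥ = χ ⊤ (dualRank r) qℤ
    in (ι χ⊥ ≃ (ι ((qℤ - + 1) ^ n) *ℚ
          sumℚ (map (λ A → ((q/[1-q] ^ℚ ∣ A ∣) *ℚ ι (χ A r qℤ)) *ℚ 1/ℕ (q Data.Nat.^ r A))
                    (allSubsets n))))
     × (ι χ⊥ ≃ (1/ℕ (q Data.Nat.^ r ⊤) *ℚ
          sumℚ (map (λ A → ι (((-[1+ 0 ] ^ (n ∸ ∣ A ∣)) * ((qℤ - + 1) ^ ∣ A ∣)) * χ (∁ A) (contractRank r A) qℤ))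
                    (allSubsets n))))
corollary2 F _ n r linear =
  dual-χ-by-restrictions isRank (FiniteField.size F) (size≥2 F) ,
  dual-χ-by-contractions isRank (FiniteField.size F) (ℕₚ.≤-trans (s≤s z≤n) (size≥2 F))
  where
    isRank : IsSubadditiveRank r
    isRank = isFLinear⇒isSubadditiveRank F linear
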